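{- Let $d\ge1$ and $s_1,\ldots,s_d\in\mathbb{N}^{\ast}$. For $n\in\mathbb{N}^{\ast}$ define the polynomial $$P_{s_1,\ldots,s_d,n}(T_1,\ldots,T_{d+1})=\sum_{0<n_1<\cdots<n_d<n}\frac{T_1^{n_1}\cdots T_d^{n_d}}{n_1^{s_1}\cdots n_d^{s_d}}\,T_{d+1}^{n}\in\mathbb{Q}[T_1,\ldots,T_{d+1}].$$ Then for every infinite subset $J\subset\mathbb{N}^{\ast}$, the element $(P_{s_1,\ldots,s_d,n})_{n\in J}$ of the product ring $\prod_{n\in J}\mathbb{Q}[T_1,\ldots,T_{d+1}]$ is transcendental over $\mathbb{Q}$, i.e. there is no nonzero $P\in\mathbb{Q}[X]$ with $P(P_{s_1,\ldots,s_d,n})=0$ for all $n\in J$.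
   Context: The product ring $\prod_{n\in J}\mathbb{Q}[T_1,\ldots,T_{d+1}]$ has componentwise operations, with $\mathbb{Q}$ embedded diagonally. -}

module Defs where

open import Data.Nat as ℕ using (ℕ; zero; suc; _<_; _<?_)
open import Data.Integer using (+_)
open import Data.Rational using (ℚ; 0ℚ; 1ℚ; _/_) renaming (_+_ to _+ℚ_; _*_ to _*ℚ_)
open import Data.Product using (_×_; _,_)
open import Data.List using (List; []; _∷_; _++_; map; concatMap; filter; upTo; foldr)
open import Data.Vec using (Vec; []; _∷_; _∷ʳ_; zipWith; replicate)
open import Data.Vec.Properties using (≡-dec)
open import Relation.Nullary using (yes; no)

-- A polynomial is represented by a finite formal sum (list) of terms
-- c · T^e with c ∈ ℚ and exponent vector e ∈ ℕ^k.  Two representations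
-- denote the same polynomial iff all their coefficients agree.

Term : ℕ → Set
Term k = ℚ × Vec ℕ k

MPoly : ℕ → Set
MPoly k = List (Term k)

coeff : ∀ {k} → MPoly k → Vec ℕ k → ℚ
coeff [] e = 0ℚ
coeff ((c , e′) ∷ p) e with ≡-dec ℕ._≟_ e′ e
... | yes _ = c +ℚ coeff p e
... | no  _ = coeff p e

IsZeroPoly : ∀ {k} → MPoly k → Set
IsZeroPoly p = ∀ e → coeff p e ≡ 0ℚ
  where open import Relation.Binary.PropositionalEquality using (_≡_)

constP : ∀ {k} → ℚ → MPoly k
constP c = (c , replicate _ 0) ∷ []

_+P_ : ∀ {k} → MPoly k → MPoly k → MPoly k
p +P q = p ++ q

_*P_ : ∀ {k} → MPoly k → MPoly k → MPoly k
p *P q = concatMap (λ { (c , e) → map (λ { (c′ , e′) → (c *ℚ c′ , zipWith ℕ._+_ e e′) }) q }) p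

-- Univariate polynomials P ∈ ℚ[X] as coefficient lists a₀ ∷ a₁ ∷ …,
-- and substitution P(f) of a multivariate polynomial f (Horner).

UPoly : Set
UPoly = List ℚ

evalAt : ∀ {k} → UPoly → MPoly k → MPoly k
evalAt [] f = []
evalAt (a ∷ as) f = constP a +P (f *P evalAt as f)

incr : (d : ℕ) → ℕ → ℕ → List (Vec ℕ d)
incr zero    lo n = [] ∷ []
incr (suc d) lo n =
  concatMap (λ m → map (m ∷_) (incr d m n)) (filter (λ m → lo <? m) (upTo n))

-- 1/N as a rational (only used for N ≥ 1; value at 0 is irrelevant)
invℕ : ℕ → ℚ
invℕ zero    = 0ℚ
invℕ (suc k) = (+ 1) / suc k

denom : ∀ {d} → Vec ℕ d → Vec ℕ d → ℕ
denom ns s = Data.Vec.foldr _ ℕ._*_ 1 (zipWith ℕ._^_ ns s)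
  where import Data.Vec

Pdn : (d : ℕ) → Vec ℕ d → ℕ → MPoly (suc d)
Pdn d s n = map (λ ns → (invℕ (denom ns s) , ns ∷ʳ n)) (incr d 0 n)

-- It suffices to show that P(P_{s,n}) ≠ 0 for a single n ∈ J with n > d,
-- and we do so by specialising the variables to the point
-- (T_1, …, T_d, T_{d+1}) = (1, …, 1, t) with t ∈ ℚ.
--
-- Evaluating a polynomial along a multiplicative map χ on
--   exponent vectors (a point of ℚ^k) is a ring homomorphism which kills the
--   zero polynomial; hence it commutes with substitution into P ∈ ℚ[X].
-- * Specialisation.  Every monomial of P_{s,n} has T_{d+1}-degree n, so at
--   (1, …, 1, t) it takes the value t^n · S with S the sum of its coefficients;
--   S > 0 because all coefficients are positive and, for n > d, there is at
--   least one term (the tuple 1 < 2 < … < d).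
-- * Small roots.  A nonzero P ∈ ℚ[X] has no nonzero root in some interval
--   [-δ, δ], δ > 0.  Choosing t ∈ (0, 1] with 0 < t^n · S ≤ δ we get
--   P(t^n · S) ≠ 0, whereas P(P_{s,n}) = 0 would force P(t^n · S) = 0.

module Submission where

open import Defs
open import Data.Nat as ℕ using (ℕ; zero; suc; NonZero)
import Data.Nat.Properties as ℕ
open import Data.Rational
  using (ℚ; 0ℚ; 1ℚ; _+_; _*_; -_; ∣_∣; 1/_; _≤_; _<_; nonNegative; positive)
  renaming (NonZero to NonZeroℚ)
import Data.Rational as ℚ
import Data.Rational.Properties as ℚ
open import Data.Rational.Solver using (module +-*-Solver)
open import Algebra.Bundles using (CommutativeRing)
open import Algebra.Properties.Semiring.Exp
  (CommutativeRing.semiring ℚ.+-*-commutativeRing) using (_^_; ^-homo-*)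
open import Data.Product using (Σ; _×_; _,_; proj₁; proj₂)
open import Data.List using (List; []; _∷_; _++_; map; length)
open import Data.List.Relation.Unary.Any as Any using (Any; here; there)
import Data.List.Relation.Unary.Any.Properties as Any
import Data.List.Relation.Unary.All.Properties as All
open import Data.List.Relation.Unary.All as All using (All; []; _∷_)
open import Data.List.Membership.Propositional using (_∈_)
open import Data.List.Membership.Propositional.Properties
  using (∈-map⁺; ∈-concatMap⁺; ∈-filter⁺; ∈-upTo⁺)
open import Data.Vec as Vec using (Vec; []; _∷_; _∷ʳ_; zipWith; replicate; last)
open import Data.Vec.Properties using (≡-dec; last-∷ʳ)
open import Data.Empty using (⊥-elim)
open import Relation.Nullary using (¬_; Dec; yes; no)
open import Relation.Binary.PropositionalEquality
open +-*-Solver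

private
  variable
    k : ℕ

-- The value Σ c · χ(e) of p along a map χ on exponent vectors.  When χ is
-- multiplicative (see IsCharacter) this is the evaluation of p at a point.
termValue : (Vec ℕ k → ℚ) → Term k → ℚ
termValue χ (c , e) = c * χ e

evalWith : (Vec ℕ k → ℚ) → MPoly k → ℚ
evalWith χ []      = 0ℚ
evalWith χ (t ∷ p) = termValue χ t + evalWith χ p

record IsCharacter (χ : Vec ℕ k → ℚ) : Set where
  field
    χ-zero : χ (replicate k 0) ≡ 1ℚ
    χ-+    : ∀ e e′ → χ (zipWith ℕ._+_ e e′) ≡ χ e * χ e′

evalWith-++ : ∀ (χ : Vec ℕ k → ℚ) p q → evalWith χ (p ++ q) ≡ evalWith χ p + evalWith χ q
evalWith-++ χ []            q = sym (ℚ.+-identityˡ _)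
evalWith-++ χ ((c , e) ∷ p) q rewrite evalWith-++ χ p q =
  sym (ℚ.+-assoc (c * χ e) (evalWith χ p) (evalWith χ q))

evalWith-map-scale : ∀ (χ : Vec ℕ k → ℚ) (h : Term k → Term k) m q →
  (∀ t → termValue χ (h t) ≡ m * termValue χ t) → evalWith χ (map h q) ≡ m * evalWith χ q
evalWith-map-scale χ h m []      scale = sym (ℚ.*-zeroʳ m)
evalWith-map-scale χ h m (t ∷ q) scale rewrite scale t | evalWith-map-scale χ h m q scale =
  sym (ℚ.*-distribˡ-+ m (termValue χ t) (evalWith χ q))

evalWith-* : ∀ {χ : Vec ℕ k → ℚ} → IsCharacter χ → ∀ p q →
  evalWith χ (p *P q) ≡ evalWith χ p * evalWith χ q
evalWith-* {χ = χ} isχ []            q = sym (ℚ.*-zeroˡ (evalWith χ q))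
evalWith-* {k} {χ} isχ ((c , e) ∷ p) q = begin
  evalWith χ (cq ++ (p *P q))                            ≡⟨ evalWith-++ χ cq (p *P q) ⟩
  evalWith χ cq + evalWith χ (p *P q)                    ≡⟨ cong₂ _+_ cq-value (evalWith-* isχ p q) ⟩
  (c * χ e) * evalWith χ q + evalWith χ p * evalWith χ q ≡⟨ sym (ℚ.*-distribʳ-+ (evalWith χ q) (c * χ e) _) ⟩
  (c * χ e + evalWith χ p) * evalWith χ q                ∎
  where
  open ≡-Reasoning
  cq : MPoly k
  cq = map (λ { (c′ , e′) → (c * c′ , zipWith ℕ._+_ e e′) }) q
  monomial* : ∀ c′ e′ → (c * c′) * χ (zipWith ℕ._+_ e e′) ≡ (c * χ e) * (c′ * χ e′)
  monomial* c′ e′ rewrite IsCharacter.χ-+ isχ e e′ =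
    solve 4 (λ c c′ x x′ → (c :* c′) :* (x :* x′) := (c :* x) :* (c′ :* x′)) refl c c′ (χ e) (χ e′)
  cq-value : evalWith χ cq ≡ (c * χ e) * evalWith χ q
  cq-value = evalWith-map-scale χ _ (c * χ e) q (λ { (c′ , e′) → monomial* c′ e′ })

value : UPoly → ℚ → ℚ
value []       y = 0ℚ
value (a ∷ as) y = a + y * value as y

evalWith-evalAt : ∀ {χ : Vec ℕ k → ℚ} → IsCharacter χ → ∀ P f →
  evalWith χ (evalAt P f) ≡ value P (evalWith χ f)
evalWith-evalAt         isχ []       f = refl
evalWith-evalAt {χ = χ} isχ (a ∷ as) f
  rewrite evalWith-++ χ (constP a) (f *P evalAt as f)
        | evalWith-* isχ f (evalAt as f)
        | evalWith-evalAt isχ as f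
        | IsCharacter.χ-zero isχ
  = cong (_+ (evalWith χ f * value as (evalWith χ f)))
         (trans (ℚ.+-identityʳ (a * 1ℚ)) (ℚ.*-identityʳ a))

_≟ᵉ_ : (e e′ : Vec ℕ k) → Dec (e ≡ e′)
_≟ᵉ_ = ≡-dec ℕ._≟_

dropExponent : Vec ℕ k → MPoly k → MPoly k
dropExponent u [] = []
dropExponent u ((c , e) ∷ p) with e ≟ᵉ u
... | yes _ = dropExponent u p
... | no  _ = (c , e) ∷ dropExponent u p

-- Dropping never lengthens the list; this is the measure of evalWith-zero.
dropExponent-length : ∀ (u : Vec ℕ k) p → length (dropExponent u p) ℕ.≤ length p
dropExponent-length u [] = ℕ.z≤n
dropExponent-length u ((c , e) ∷ p) with e ≟ᵉ u
... | yes _ = ℕ.m≤n⇒m≤1+n (dropExponent-length u p)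
... | no  _ = ℕ.s≤s (dropExponent-length u p)

coeff-head : ∀ c (u : Vec ℕ k) p → coeff ((c , u) ∷ p) u ≡ c + coeff p u
coeff-head c u p with u ≟ᵉ u
... | yes _   = refl
... | no  u≢u = ⊥-elim (u≢u refl)

coeff-head-other : ∀ c {u e : Vec ℕ k} p → e ≢ u → coeff ((c , u) ∷ p) e ≡ coeff p e
coeff-head-other c {u} {e} p e≢u with u ≟ᵉ e
... | yes u≡e = ⊥-elim (e≢u (sym u≡e))
... | no  _   = refl

dropExponent-coeff-same : ∀ (u : Vec ℕ k) p → coeff (dropExponent u p) u ≡ 0ℚ
dropExponent-coeff-same u [] = refl
dropExponent-coeff-same u ((c , e) ∷ p) with e ≟ᵉ u
... | yes _   = dropExponent-coeff-same u p
... | no  e≢u = trans (coeff-head-other c (dropExponent u p) (λ u≡e → e≢u (sym u≡e)))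
                      (dropExponent-coeff-same u p)

dropExponent-coeff-other : ∀ {u e : Vec ℕ k} p → e ≢ u → coeff (dropExponent u p) e ≡ coeff p e
dropExponent-coeff-other [] e≢u = refl
dropExponent-coeff-other {u = u} {e} ((c , e′) ∷ p) e≢u with e′ ≟ᵉ u
... | yes refl = trans (dropExponent-coeff-other p e≢u) (sym (coeff-head-other c p e≢u))
... | no  _ with e′ ≟ᵉ e
...   | yes _ = cong (c +_) (dropExponent-coeff-other p e≢u)
...   | no  _ = dropExponent-coeff-other p e≢u

evalWith-split : ∀ (χ : Vec ℕ k → ℚ) u p →
  evalWith χ p ≡ χ u * coeff p u + evalWith χ (dropExponent u p)
evalWith-split χ u [] = sym (trans (ℚ.+-identityʳ _) (ℚ.*-zeroʳ (χ u)))
evalWith-split χ u ((c , e) ∷ p) with e ≟ᵉ u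
... | yes refl rewrite evalWith-split χ u p =
  solve 4 (λ c x a r → c :* x :+ (x :* a :+ r) := x :* (c :+ a) :+ r)
        refl c (χ u) (coeff p u) (evalWith χ (dropExponent u p))
... | no _ rewrite evalWith-split χ u p =
  solve 5 (λ c y x a r → c :* y :+ (x :* a :+ r) := x :* a :+ (c :* y :+ r))
        refl c (χ e) (χ u) (coeff p u) (evalWith χ (dropExponent u p))

-- Induction on the number of terms: split off all terms sharing the
-- exponent of the head term, whose total coefficient is 0.
evalWith-zero : ∀ (χ : Vec ℕ k → ℚ) p → IsZeroPoly p → evalWith χ p ≡ 0ℚ
evalWith-zero {k} χ p = bounded (length p) p ℕ.≤-refl
  where
  open ≡-Reasoning
  bounded : ∀ n p → length p ℕ.≤ n → IsZeroPoly p → evalWith χ p ≡ 0ℚ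
  bounded _       []            _             _ = refl
  bounded (suc n) ((c , u) ∷ q) (ℕ.s≤s len≤n) z = begin
    c * χ u + evalWith χ q                             ≡⟨ cong (c * χ u +_) (evalWith-split χ u q) ⟩
    c * χ u + (χ u * coeff q u + evalWith χ rest)      ≡⟨ solve 4 (λ c x a r → c :* x :+ (x :* a :+ r)
                                                                          := x :* (c :+ a) :+ r)
                                                              refl c (χ u) (coeff q u) (evalWith χ rest) ⟩
    χ u * (c + coeff q u) + evalWith χ rest            ≡⟨ cong₂ (λ a r → χ u * a + r)
                                                              (trans (sym (coeff-head c u q)) (z u))
                                                              (bounded n rest rest-length rest-zero) ⟩
    χ u * 0ℚ + 0ℚ                                      ≡⟨ trans (ℚ.+-identityʳ _) (ℚ.*-zeroʳ (χ u)) ⟩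
    0ℚ                                                 ∎
    where
    rest : MPoly k
    rest = dropExponent u q
    rest-length : length rest ℕ.≤ n
    rest-length = ℕ.≤-trans (dropExponent-length u q) len≤n
    rest-zero : IsZeroPoly rest
    rest-zero e with e ≟ᵉ u
    ... | yes refl = dropExponent-coeff-same u q
    ... | no  e≢u  = trans (dropExponent-coeff-other q e≢u)
                           (trans (sym (coeff-head-other c q e≢u)) (z e))

-- T^e evaluated at (1, …, 1, t).
lastPower : ℚ → Vec ℕ (suc k) → ℚ
lastPower t e = t ^ last e

last-zipWith : ∀ (e e′ : Vec ℕ (suc k)) → last (zipWith ℕ._+_ e e′) ≡ last e ℕ.+ last e′
last-zipWith {zero}  (x ∷ []) (x′ ∷ [])  = refl
last-zipWith {suc k} (x ∷ e)  (x′ ∷ e′) = last-zipWith e e′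

last-replicate : ∀ k → last (replicate (suc k) 0) ≡ 0
last-replicate zero    = refl
last-replicate (suc k) = last-replicate k

lastPower-isCharacter : ∀ t → IsCharacter (lastPower {k} t)
lastPower-isCharacter {k} t = record
  { χ-zero = cong (t ^_) (last-replicate k)
  ; χ-+    = λ e e′ → trans (cong (t ^_) (last-zipWith e e′)) (^-homo-* t (last e) (last e′))
  }

coefficientSum : MPoly k → ℚ
coefficientSum []            = 0ℚ
coefficientSum ((c , e) ∷ p) = c + coefficientSum p

evalWith-lastPower : ∀ t n (p : MPoly (suc k)) → All (λ term → last (proj₂ term) ≡ n) p →
  evalWith (lastPower t) p ≡ t ^ n * coefficientSum p
evalWith-lastPower t n []            []           = sym (ℚ.*-zeroʳ (t ^ n))
evalWith-lastPower t n ((c , e) ∷ p) (refl ∷ hom) rewrite evalWith-lastPower t n p hom =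
  solve 3 (λ c x s → c :* x :+ x :* s := x :* (c :+ s)) refl c (t ^ last e) (coefficientSum p)

coefficientSum-nonNeg : ∀ (p : MPoly k) → All (λ term → 0ℚ ≤ proj₁ term) p → 0ℚ ≤ coefficientSum p
coefficientSum-nonNeg []            []          = ℚ.≤-refl
coefficientSum-nonNeg ((c , e) ∷ p) (c≥0 ∷ p≥0) = ℚ.+-mono-≤ c≥0 (coefficientSum-nonNeg p p≥0)

coefficientSum-pos : ∀ (p : MPoly k) → All (λ term → 0ℚ ≤ proj₁ term) p →
  Any (λ term → 0ℚ < proj₁ term) p → 0ℚ < coefficientSum p
coefficientSum-pos ((c , e) ∷ p) (c≥0 ∷ p≥0) (here c>0)  = ℚ.+-mono-<-≤ c>0 (coefficientSum-nonNeg p p≥0)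
coefficientSum-pos ((c , e) ∷ p) (c≥0 ∷ p≥0) (there p>0) = ℚ.+-mono-≤-< c≥0 (coefficientSum-pos p p≥0 p>0)

*-mono-≤-nonNeg : ∀ {a b c d} → 0ℚ ≤ a → 0ℚ ≤ c → a ≤ b → c ≤ d → a * c ≤ b * d
*-mono-≤-nonNeg {b = b} {c} a≥0 c≥0 a≤b c≤d =
  ℚ.≤-trans (ℚ.*-monoʳ-≤-nonNeg c {{nonNegative c≥0}} a≤b)
            (ℚ.*-monoˡ-≤-nonNeg b {{nonNegative (ℚ.≤-trans a≥0 a≤b)}} c≤d)

fractionBelow : ∀ {a b} → 0ℚ < a → 0ℚ ≤ b → Σ ℚ (λ q → 0ℚ < q × q ≤ 1ℚ × q * b < a)
fractionBelow {a} {b} a>0 b≥0 = q , q>0 , q≤1 , qb<a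
  where
  a+b>0 : 0ℚ < a + b
  a+b>0 = ℚ.+-mono-<-≤ a>0 b≥0
  instance
    a+b≢0 : NonZeroℚ (a + b)
    a+b≢0 = ℚ.>-nonZero a+b>0
  q : ℚ
  q = a * 1/ (a + b)
  q[a+b]≡a : q * (a + b) ≡ a
  q[a+b]≡a = trans (ℚ.*-assoc a (1/ (a + b)) (a + b))
                   (trans (cong (a *_) (ℚ.*-inverseˡ (a + b))) (ℚ.*-identityʳ a))
  q>0 : 0ℚ < q
  q>0 = ℚ.*-cancelʳ-<-nonNeg (a + b) {{nonNegative (ℚ.<⇒≤ a+b>0)}}
          (subst₂ _<_ (sym (ℚ.*-zeroˡ (a + b))) (sym q[a+b]≡a) a>0)
  q≤1 : q ≤ 1ℚ
  q≤1 = ℚ.*-cancelʳ-≤-pos (a + b) {{positive a+b>0}}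
          (subst₂ _≤_ (sym q[a+b]≡a) (sym (ℚ.*-identityˡ (a + b)))
                  (subst (_≤ a + b) (ℚ.+-identityʳ a) (ℚ.+-monoʳ-≤ a b≥0)))
  qb<a : q * b < a
  qb<a = subst₂ _<_ (ℚ.+-identityˡ (q * b)) (trans (sym (ℚ.*-distribˡ-+ q a b)) q[a+b]≡a)
           (ℚ.+-mono-<-≤ (ℚ.positive⁻¹ (q * a) {{ℚ.pos*pos⇒pos q {{positive q>0}} a {{positive a>0}}}})
                         ℚ.≤-refl)

norm₁ : UPoly → ℚ
norm₁ []       = 0ℚ
norm₁ (a ∷ as) = ∣ a ∣ + norm₁ as

norm₁-nonNeg : ∀ P → 0ℚ ≤ norm₁ P
norm₁-nonNeg []       = ℚ.≤-refl
norm₁-nonNeg (a ∷ as) = ℚ.+-mono-≤ (ℚ.0≤∣p∣ a) (norm₁-nonNeg as)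

value-bound : ∀ P y → ∣ y ∣ ≤ 1ℚ → ∣ value P y ∣ ≤ norm₁ P
value-bound []       y |y|≤1 = ℚ.≤-refl
value-bound (a ∷ as) y |y|≤1 =
  ℚ.≤-trans (ℚ.∣p+q∣≤∣p∣+∣q∣ a (y * v))
            (ℚ.+-monoʳ-≤ ∣ a ∣ (subst₂ _≤_ (sym (ℚ.∣p*q∣≡∣p∣*∣q∣ y v)) (ℚ.*-identityˡ (norm₁ as))
                                   (*-mono-≤-nonNeg (ℚ.0≤∣p∣ y) (ℚ.0≤∣p∣ v) |y|≤1 (value-bound as y |y|≤1))))
  where
  v : ℚ
  v = value as y

NoSmallRoot : UPoly → Set
NoSmallRoot P = Σ ℚ (λ δ → 0ℚ < δ × (∀ y → y ≢ 0ℚ → ∣ y ∣ ≤ δ → value P y ≢ 0ℚ))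

∣∣-pos : ∀ {a} → a ≢ 0ℚ → 0ℚ < ∣ a ∣
∣∣-pos {a} a≢0 = ℚ.positive⁻¹ ∣ a ∣ {{ℚ.nonNeg∧nonZero⇒pos ∣ a ∣ {{ℚ.∣-∣-nonNeg a}}
                                      {{ℚ.≢-nonZero (λ |a|≡0 → a≢0 (ℚ.∣p∣≡0⇒p≡0 a |a|≡0))}}}}

-- A polynomial a + X·Q with a ≠ 0 has no root at all near 0: at a root,
-- |a| = |y| · |Q(y)| ≤ δ · ‖Q‖₁ < |a| for δ chosen by fractionBelow.
noSmallRoot-constant : ∀ a Q → a ≢ 0ℚ → NoSmallRoot (a ∷ Q)
noSmallRoot-constant a Q a≢0 with fractionBelow (∣∣-pos a≢0) (norm₁-nonNeg Q)
... | δ , δ>0 , δ≤1 , δ‖Q‖<|a| = δ , δ>0 , λ y _ |y|≤δ → noRoot y |y|≤δ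
  where
  noRoot : ∀ y → ∣ y ∣ ≤ δ → value (a ∷ Q) y ≢ 0ℚ
  noRoot y |y|≤δ root = ℚ.<-irrefl refl (ℚ.≤-<-trans |a|≤δ‖Q‖ δ‖Q‖<|a|)
    where
    v : ℚ
    v = value Q y
    a≡-yv : a ≡ - (y * v)
    a≡-yv = trans (solve 2 (λ a w → a := (a :+ w) :+ (:- w)) refl a (y * v))
                  (trans (cong (_+ - (y * v)) root) (ℚ.+-identityˡ _))
    |a|≤δ‖Q‖ : ∣ a ∣ ≤ δ * norm₁ Q
    |a|≤δ‖Q‖ = subst (_≤ δ * norm₁ Q)
                 (sym (trans (cong ∣_∣ a≡-yv) (trans (ℚ.∣-p∣≡∣p∣ (y * v)) (ℚ.∣p*q∣≡∣p∣*∣q∣ y v))))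
                 (*-mono-≤-nonNeg (ℚ.0≤∣p∣ y) (ℚ.0≤∣p∣ v) |y|≤δ
                                  (value-bound Q y (ℚ.≤-trans |y|≤δ δ≤1)))

*-cancel-zero : ∀ y h → y ≢ 0ℚ → y * h ≡ 0ℚ → h ≡ 0ℚ
*-cancel-zero y h y≢0 yh≡0 = begin
  h                ≡⟨ sym (ℚ.*-identityˡ h) ⟩
  1ℚ * h           ≡⟨ cong (_* h) (sym (ℚ.*-inverseˡ y)) ⟩
  (1/ y) * y * h   ≡⟨ ℚ.*-assoc (1/ y) y h ⟩
  (1/ y) * (y * h) ≡⟨ cong ((1/ y) *_) yh≡0 ⟩
  (1/ y) * 0ℚ      ≡⟨ ℚ.*-zeroʳ (1/ y) ⟩
  0ℚ               ∎
  where
  open ≡-Reasoning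
  instance
    y≢0′ : NonZeroℚ y
    y≢0′ = ℚ.≢-nonZero y≢0

-- A polynomial with some nonzero coefficient has no small nonzero root:
-- strip the leading zero coefficients (P = X^m · Q with Q(0) ≠ 0).
noSmallRoot : ∀ P → Any (_≢ 0ℚ) P → NoSmallRoot P
noSmallRoot (a ∷ Q) (here a≢0) = noSmallRoot-constant a Q a≢0
noSmallRoot (a ∷ Q) (there Q≢0) with a ℚ.≟ 0ℚ
... | no  a≢0 = noSmallRoot-constant a Q a≢0
... | yes refl with noSmallRoot Q Q≢0
...   | δ , δ>0 , noRoot = δ , δ>0 , λ y y≢0 |y|≤δ root →
        noRoot y y≢0 |y|≤δ (*-cancel-zero y (value Q y) y≢0 (trans (sym (ℚ.+-identityˡ _)) root))

^-pos : ∀ {t} → 0ℚ < t → ∀ n → 0ℚ < t ^ n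
^-pos     t>0 zero    = ℚ.positive⁻¹ 1ℚ
^-pos {t} t>0 (suc n) = ℚ.positive⁻¹ (t * t ^ n)
  {{ℚ.pos*pos⇒pos t {{positive t>0}} (t ^ n) {{positive (^-pos t>0 n)}}}}

^-suc-≤ : ∀ {t} → 0ℚ ≤ t → t ≤ 1ℚ → ∀ k → t ^ suc k ≤ t
^-suc-≤ {t} t≥0 t≤1 k = subst (t * t ^ k ≤_) (ℚ.*-identityʳ t)
                              (ℚ.*-monoˡ-≤-nonNeg t {{nonNegative t≥0}} (^-≤-1 k))
  where
  ^-≤-1 : ∀ k → t ^ k ≤ 1ℚ
  ^-≤-1 zero    = ℚ.≤-refl
  ^-≤-1 (suc k) = ℚ.≤-trans (^-suc-≤ t≥0 t≤1 k) t≤1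

smallPositiveValue : ∀ {S δ} k → 0ℚ < S → 0ℚ < δ →
  Σ ℚ (λ t → 0ℚ < t ^ suc k * S × t ^ suc k * S ≤ δ)
smallPositiveValue {S} {δ} k S>0 δ>0 with fractionBelow δ>0 (ℚ.<⇒≤ S>0)
... | t , t>0 , t≤1 , tS<δ = t , y>0 , y≤δ
  where
  y>0 : 0ℚ < t ^ suc k * S
  y>0 = ℚ.positive⁻¹ (t ^ suc k * S)
          {{ℚ.pos*pos⇒pos (t ^ suc k) {{positive (^-pos t>0 (suc k))}} S {{positive S>0}}}}
  y≤δ : t ^ suc k * S ≤ δ
  y≤δ = ℚ.≤-trans (ℚ.*-monoʳ-≤-nonNeg S {{nonNegative (ℚ.<⇒≤ S>0)}} (^-suc-≤ (ℚ.<⇒≤ t>0) t≤1 k))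
                  (ℚ.<⇒≤ tS<δ)

run : ℕ → (d : ℕ) → Vec ℕ d
run lo zero    = []
run lo (suc d) = suc lo ∷ run (suc lo) d

run∈incr : ∀ d lo n → lo ℕ.+ d ℕ.< n → run lo d ∈ incr d lo n
run∈incr zero    lo n _        = here refl
run∈incr (suc d) lo n lo+d+1<n =
  ∈-concatMap⁺ (λ m → map (m ∷_) (incr d m n))
    (Any.map (λ { refl → ∈-map⁺ (suc lo ∷_) (run∈incr d (suc lo) n lo+1+d<n) })
             (∈-filter⁺ (λ m → lo ℕ.<? m) (∈-upTo⁺ lo+1<n) (ℕ.n<1+n lo)))
  where
  lo+1+d<n : suc lo ℕ.+ d ℕ.< n
  lo+1+d<n = subst (ℕ._< n) (ℕ.+-suc lo d) lo+d+1<n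
  lo+1<n : suc lo ℕ.< n
  lo+1<n = ℕ.≤-<-trans (ℕ.m≤m+n (suc lo) d) lo+1+d<n

denom-run-nonZero : ∀ lo {d} (s : Vec ℕ d) → NonZero (denom (run lo d) s)
denom-run-nonZero lo []      = _
denom-run-nonZero lo (x ∷ s) =
  ℕ.m*n≢0 (suc lo ℕ.^ x) (denom (run (suc lo) _) s)
    {{ℕ.m^n≢0 (suc lo) x}} {{denom-run-nonZero (suc lo) s}}

invℕ-nonNeg : ∀ m → 0ℚ ≤ invℕ m
invℕ-nonNeg zero    = ℚ.≤-refl
invℕ-nonNeg (suc m) = ℚ.nonNegative⁻¹ _ {{ℚ.normalize-nonNeg 1 (suc m)}}

invℕ-pos : ∀ m → .{{NonZero m}} → 0ℚ < invℕ m
invℕ-pos (suc m) = ℚ.positive⁻¹ _ {{ℚ.normalize-pos 1 (suc m)}}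

Pdn-lastExponent : ∀ d s n → All (λ term → last (proj₂ term) ≡ n) (Pdn d s n)
Pdn-lastExponent d s n = All.map⁺ (All.universal (λ ns → last-∷ʳ n ns) (incr d 0 n))

-- The coefficients sum to a positive number once n > d: all are ≥ 0 and
-- the one of the tuple 1 < 2 < … < d is > 0.
Pdn-coefficientSum-pos : ∀ d s n → d ℕ.< n → 0ℚ < coefficientSum (Pdn d s n)
Pdn-coefficientSum-pos d s n d<n = coefficientSum-pos (Pdn d s n)
  (All.map⁺ (All.universal (λ ns → invℕ-nonNeg (denom ns s)) (incr d 0 n)))
  (Any.map⁺ (Any.map (λ { refl → invℕ-pos _ {{denom-run-nonZero 0 s}} }) (run∈incr d 0 n d<n)))

evalAt-Pdn-nonzero : ∀ d (s : Vec ℕ d) n P → d ℕ.< n → Any (_≢ 0ℚ) P →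
  ¬ IsZeroPoly (evalAt P (Pdn d s n))
evalAt-Pdn-nonzero d s n@(suc k) P d<n P≢0 P[Pdn]≡0
  with noSmallRoot P P≢0
... | δ , δ>0 , noRoot
  with smallPositiveValue k (Pdn-coefficientSum-pos d s n d<n) δ>0
... | t , y>0 , y≤δ = noRoot y (λ y≡0 → ℚ.<-irrefl (sym y≡0) y>0)
                            (subst (_≤ δ) (sym (ℚ.0≤p⇒∣p∣≡p (ℚ.<⇒≤ y>0))) y≤δ) P[y]≡0
  where
  open ≡-Reasoning
  y : ℚ
  y = t ^ n * coefficientSum (Pdn d s n)
  -- specialise P(P_{s,n}) = 0 at (1, …, 1, t), where P_{s,n} takes the value y
  P[y]≡0 : value P y ≡ 0ℚ
  P[y]≡0 = begin
    value P y                                         ≡⟨ cong (value P) (sym (evalWith-lastPower t n (Pdn d s n)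
                                                                                (Pdn-lastExponent d s n))) ⟩
    value P (evalWith (lastPower t) (Pdn d s n))      ≡⟨ sym (evalWith-evalAt (lastPower-isCharacter t) P (Pdn d s n)) ⟩
    evalWith (lastPower t) (evalAt P (Pdn d s n))     ≡⟨ evalWith-zero (lastPower t) (evalAt P (Pdn d s n)) P[Pdn]≡0 ⟩
    0ℚ                                                ∎

mainTheorem4 : (d : ℕ) → 1 ℕ.≤ d → (s : Vec ℕ d) → (∀ i → 1 ℕ.≤ Vec.lookup s i)
    → (J : ℕ → Set) → (∀ n → J n → 1 ℕ.≤ n) → (∀ m → Σ ℕ (λ n → m ℕ.≤ n × J n))
    → (P : UPoly) → Any (λ a → a ≢ 0ℚ) P
    → ¬ (∀ n → J n → IsZeroPoly (evalAt P (Pdn d s n)))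
mainTheorem4 d _ s _ J _ J-unbounded P P≢0 P[Pdn]≡0
  with J-unbounded (suc d)
... | n , d<n , n∈J = evalAt-Pdn-nonzero d s n P d<n P≢0 (P[Pdn]≡0 n n∈J)
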